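{- Let $P$ and $Q$ be non-negative integers with binary digits $P=a_{n+1}a_n\cdots a_1$ and $Q=b_{n+1}b_n\cdots b_1$ ($a_1,b_1$ least significant; digits beyond these are taken to be $0$), and suppose $(P,Q)$ is a non-leaf node, i.e. there exists at least one pair $(X,Y)$ of non-negative integers with $\mathrm{CVT}(X,Y)=P$ and $\mathrm{XOR}(X,Y)=Q$. Let $m$ be the number of indices $i$ with $1\le i\le n+1$ such that $a_{i+1}=0$ and $b_i=1$. Then the number of pairs $(X,Y)$ of non-negative integers with $\mathrm{CVT}(X,Y)=P$ and $\mathrm{XOR}(X,Y)=Q$ is exactly $2^m$. These pairs are obtained by choosing, at each of these $m$ bit positions $i$, the bits $(x_i,y_i)$ of $(X,Y)$ to be either $(0,1)$ or $(1,0)$, while the bits at the other positions are fixed.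
   Context: For non-negative integers $X,Y$ written in binary, $\mathrm{XOR}(X,Y)$ is their bitwise exclusive or, and $\mathrm{CVT}(X,Y)=2\cdot(X \mathbin{\mathrm{AND}} Y)$ (bitwise AND shifted one position left, so bit $i+1$ of $\mathrm{CVT}(X,Y)$ is $x_i \mathbin{\mathrm{AND}} y_i$, where $x_i,y_i$ are bit $i$ of $X,Y$, and bit $1$ of $\mathrm{CVT}(X,Y)$ is $0$). In the CVT-XOR Tree with root $(0,N)$, nodes are pairs $(X,Y)$ of non-negative integers with $X+Y=N$, and the successors (children) of a node $(P,Q)$ are the pairs $(X,Y)$ with $(\mathrm{CVT}(X,Y),\mathrm{XOR}(X,Y))=(P,Q)$; a node is non-leaf if it has at least one such successor. -}

module Defs where

open import Data.Nat using (ℕ; zero; suc; _+_; _*_; _∸_; _^_; _<_; _≟_)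
open import Data.Nat.DivMod using (_/_; _%_)
open import Data.Product using (Σ; _×_; _,_; ∃)
open import Data.List using (List; length; filter; upTo)
open import Relation.Nullary.Decidable using (_×-dec_)
open import Relation.Binary.PropositionalEquality using (_≡_)

-- bit i of X (= (X / 2^i) mod 2), 0-indexed (bit 0 = least significant).
-- 1-indexed digit x_i is  bit X (i ∸ 1).
bit : ℕ → ℕ → ℕ
bit X zero    = X % 2
bit X (suc i) = bit (X / 2) i

xorAux : ℕ → ℕ → ℕ → ℕ
xorAux zero    x y = 0
xorAux (suc k) x y = ((x % 2 + y % 2) % 2) + 2 * xorAux k (x / 2) (y / 2)

andAux : ℕ → ℕ → ℕ → ℕ
andAux zero    x y = 0
andAux (suc k) x y = ((x % 2) * (y % 2)) + 2 * andAux k (x / 2) (y / 2)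

-- fuel x + y exceeds the bit length of both x and y
XOR : ℕ → ℕ → ℕ
XOR x y = xorAux (x + y) x y

AND : ℕ → ℕ → ℕ
AND x y = andAux (x + y) x y

CVT : ℕ → ℕ → ℕ
CVT x y = 2 * AND x y

Successors : ℕ → ℕ → Set
Successors P Q = Σ (ℕ × ℕ) (λ { (X , Y) → CVT X Y ≡ P × XOR X Y ≡ Q })

NonLeaf : ℕ → ℕ → Set
NonLeaf P Q = Successors P Q

-- Special position, 0-indexed j = i - 1 with 1 ≤ i ≤ n+1:
-- a_{i+1} = bit P (suc j) = 0 and b_i = bit Q j = 1.
Special : ℕ → ℕ → ℕ → ℕ → Set
Special n P Q j = j < suc n × bit P (suc j) ≡ 0 × bit Q j ≡ 1

countM : ℕ → ℕ → ℕ → ℕ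
countM n P Q = length (filter (λ j → (bit P (suc j) ≟ 0) ×-dec (bit Q j ≟ 1)) (upTo (suc n)))

-- A successor (X , Y) of (P , Q) satisfies CVT X Y = 2 * AND X Y = P, so P is even
-- and the successors are the solutions of the system  AND X Y = A, XOR X Y = Q
-- with A = P / 2.  Both operations act digit by digit, so a solution is the same
-- as a choice of a last digit pair (u , v) with u * v = A mod 2, u xor v = Q mod 2,
-- together with a solution of the halved system (A / 2 , Q / 2)  [solution-split].
-- For a digit position with carry digit a and xor digit q there are two digit
-- pairs, (0 , 1) and (1 , 0), when a = 0 and q = 1 (a free position), and
-- otherwise at most one, namely (a , a) for q = 0  [digitPairs-free,
-- digitPair-forced].  Induction on the number of digits then shows that a
-- solvable system has 2^(number of free positions) solutions  [count]; the base
-- case uses X + Y = XOR X Y + CVT X Y  [sum-split].  Reading the digit pairs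
-- position by position  [bit-pair]  gives the description of the digits of the
-- successors at special and non-special positions.

module Submission where

open import Defs
open import Data.Nat
open import Data.Nat.Properties
open import Data.Nat.DivMod
open import Data.Fin using (Fin; zero; suc)
open import Data.Fin.Properties using (*↔×)
open import Data.Product
open import Data.Product.Function.NonDependent.Propositional using (_×-↔_)
open import Data.Sum
open import Data.Bool using (true; false)
open import Data.Empty using (⊥-elim)
open import Data.List using (length; filter; upTo; applyUpTo)
open import Data.List.Properties using (filter-accept; filter-reject)
open import Relation.Nullary using (¬_; Dec; yes; no; does)
open import Relation.Nullary.Decidable using (_×-dec_)
open import Relation.Unary using (Pred; Decidable)
open import Function using (_∘_)
open import Function.Bundles using (_↔_; mk↔ₛ′; Inverse)
open import Function.Related.Propositional using (module EquationalReasoning)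
open import Relation.Binary.PropositionalEquality
open import Data.Nat.Tactic.RingSolver using (solve-∀)

digit-or-half : ∀ X → X ≡ X % 2 + 2 * (X / 2)
digit-or-half X = trans (m≡m%n+[m/n]*n X 2) (cong (X % 2 +_) (*-comm (X / 2) 2))

digit-of : ∀ b Z → b < 2 → (b + 2 * Z) % 2 ≡ b
digit-of b Z b<2 = begin
  (b + 2 * Z) % 2 ≡⟨ cong (λ t → (b + t) % 2) (*-comm 2 Z) ⟩
  (b + Z * 2) % 2 ≡⟨ [m+kn]%n≡m%n b Z 2 ⟩
  b % 2           ≡⟨ m<n⇒m%n≡m b<2 ⟩
  b               ∎
  where open ≡-Reasoning

half-of : ∀ b Z → b < 2 → (b + 2 * Z) / 2 ≡ Z
half-of b Z b<2 = begin
  (b + 2 * Z) / 2     ≡⟨ cong (λ t → (b + t) / 2) (*-comm 2 Z) ⟩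
  (b + Z * 2) / 2     ≡⟨ +-distrib-/ b (Z * 2) low-sum ⟩
  b / 2 + Z * 2 / 2   ≡⟨ cong₂ _+_ (m<n⇒m/n≡0 b<2) (m*n/n≡m Z 2) ⟩
  Z                   ∎
  where
  open ≡-Reasoning
  low-sum : b % 2 + Z * 2 % 2 < 2
  low-sum = subst (_< 2) (sym (trans (cong₂ _+_ (m<n⇒m%n≡m b<2) (m*n%n≡0 Z 2)) (+-identityʳ b))) b<2

split-digit : ∀ {b Z} A → b < 2 → b + 2 * Z ≡ A → b ≡ A % 2 × Z ≡ A / 2
split-digit {b} {Z} A b<2 refl = sym (digit-of b Z b<2) , sym (half-of b Z b<2)

join-digit : ∀ {b Z} A → b ≡ A % 2 → Z ≡ A / 2 → b + 2 * Z ≡ A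
join-digit A refl refl = sym (digit-or-half A)

half-≤ : ∀ {x k} → x ≤ suc k → x / 2 ≤ k
half-≤ {zero}  _    = z≤n
half-≤ {suc x} x≤1+k = ≤-pred (≤-trans (m/n<m (suc x) 2 (s≤s (s≤s z≤n))) x≤1+k)

-- XOR and AND are instances of one scheme: a digit operation g applied to the
-- last digits, the rest computed on the halves, with a fuel bound on the
-- number of digits.
module Digitwise (op : ℕ → ℕ → ℕ → ℕ) (g : ℕ → ℕ → ℕ)
  (op-zero : ∀ x y → op 0 x y ≡ 0)
  (op-suc  : ∀ k x y → op (suc k) x y ≡ g (x % 2) (y % 2) + 2 * op k (x / 2) (y / 2))
  (g-zero  : g 0 0 ≡ 0)
  (g-digit : ∀ u v → u < 2 → v < 2 → g u v < 2)
  where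

  run : ℕ → ℕ → ℕ
  run x y = op (x + y) x y

  op-zeros : ∀ k → op k 0 0 ≡ 0
  op-zeros zero    = op-zero 0 0
  op-zeros (suc k) = trans (op-suc k 0 0) (cong₂ (λ a b → a + 2 * b) g-zero (op-zeros k))

  fuel-irrelevant : ∀ k k' {x y} → x ≤ k → y ≤ k → x ≤ k' → y ≤ k' → op k x y ≡ op k' x y
  fuel-irrelevant zero    k'      z≤n z≤n _   _   = trans (op-zero 0 0) (sym (op-zeros k'))
  fuel-irrelevant (suc k) zero    _   _   z≤n z≤n = trans (op-zeros (suc k)) (sym (op-zero 0 0))
  fuel-irrelevant (suc k) (suc k') {x} {y} x≤k y≤k x≤k' y≤k' = begin
    op (suc k) x y                                ≡⟨ op-suc k x y ⟩
    g (x % 2) (y % 2) + 2 * op k (x / 2) (y / 2)   ≡⟨ cong (λ r → g (x % 2) (y % 2) + 2 * r)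
                                                     (fuel-irrelevant k k' (half-≤ x≤k) (half-≤ y≤k) (half-≤ x≤k') (half-≤ y≤k')) ⟩
    g (x % 2) (y % 2) + 2 * op k' (x / 2) (y / 2)  ≡⟨ op-suc k' x y ⟨
    op (suc k') x y                               ∎
    where open ≡-Reasoning

  run-step : ∀ x y → run x y ≡ g (x % 2) (y % 2) + 2 * run (x / 2) (y / 2)
  run-step x y = begin
    op (x + y) x y                                      ≡⟨ fuel-irrelevant (x + y) (suc (x + y)) x≤ y≤ (m≤n⇒m≤1+n x≤) (m≤n⇒m≤1+n y≤) ⟩
    op (suc (x + y)) x y                                ≡⟨ op-suc (x + y) x y ⟩
    g (x % 2) (y % 2) + 2 * op (x + y) (x / 2) (y / 2)  ≡⟨ cong (λ r → g (x % 2) (y % 2) + 2 * r)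
                                                          (fuel-irrelevant (x + y) (x / 2 + y / 2)
                                                            (≤-trans (m/n≤m x 2) x≤) (≤-trans (m/n≤m y 2) y≤)
                                                            (m≤m+n (x / 2) (y / 2)) (m≤n+m (y / 2) (x / 2))) ⟩
    g (x % 2) (y % 2) + 2 * run (x / 2) (y / 2)         ∎
    where
    open ≡-Reasoning
    x≤ : x ≤ x + y
    x≤ = m≤m+n x y
    y≤ : y ≤ x + y
    y≤ = m≤n+m y x

  run-split : ∀ X Y A → run X Y ≡ A → g (X % 2) (Y % 2) ≡ A % 2 × run (X / 2) (Y / 2) ≡ A / 2
  run-split X Y A eq =
    split-digit A (g-digit _ _ (m%n<n X 2) (m%n<n Y 2)) (trans (sym (run-step X Y)) eq)

  run-join : ∀ {u v} X Y A → u < 2 → v < 2 → g u v ≡ A % 2 → run X Y ≡ A / 2 →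
             run (u + 2 * X) (v + 2 * Y) ≡ A
  run-join {u} {v} X Y A u<2 v<2 low high = begin
    run (u + 2 * X) (v + 2 * Y)                   ≡⟨ run-step (u + 2 * X) (v + 2 * Y) ⟩
    g ((u + 2 * X) % 2) ((v + 2 * Y) % 2)
      + 2 * run ((u + 2 * X) / 2) ((v + 2 * Y) / 2) ≡⟨ cong₂ (λ a b → a + 2 * b)
                                                       (cong₂ g (digit-of u X u<2) (digit-of v Y v<2))
                                                       (cong₂ run (half-of u X u<2) (half-of v Y v<2)) ⟩
    g u v + 2 * run X Y                           ≡⟨ join-digit A low high ⟩
    A                                             ∎
    where open ≡-Reasoning

*-digit : ∀ {u v} → u < 2 → v < 2 → u * v < 2
*-digit u<2 v<2 = s≤s (*-mono-≤ (≤-pred u<2) (≤-pred v<2))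

private
  module Xor = Digitwise xorAux (λ u v → (u + v) % 2) (λ _ _ → refl) (λ _ _ _ → refl) refl
                 (λ u v _ _ → m%n<n (u + v) 2)
  module And = Digitwise andAux _*_ (λ _ _ → refl) (λ _ _ _ → refl) refl (λ _ _ → *-digit)

digit-sum : ∀ u v → u < 2 → v < 2 → (u + v) % 2 + 2 * (u * v) ≡ u + v
digit-sum 0 0 _ _ = refl
digit-sum 0 1 _ _ = refl
digit-sum 1 0 _ _ = refl
digit-sum 1 1 _ _ = refl
digit-sum (suc (suc _)) _ (s≤s (s≤s ())) _
digit-sum 0 (suc (suc _)) _ (s≤s (s≤s ()))
digit-sum 1 (suc (suc _)) _ (s≤s (s≤s ()))

interchange : ∀ a b c d → (a + 2 * b) + 2 * (c + 2 * d) ≡ (a + 2 * c) + 2 * (b + 2 * d)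
interchange = solve-∀

regroup : ∀ a b c d → (a + b) + 2 * (c + d) ≡ (a + 2 * c) + (b + 2 * d)
regroup = solve-∀

xor-and-sum-fuel : ∀ k {x y} → x ≤ k → y ≤ k → xorAux k x y + 2 * andAux k x y ≡ x + y
xor-and-sum-fuel zero    z≤n z≤n = refl
xor-and-sum-fuel (suc k) {x} {y} x≤ y≤ = begin
  (u ⊕ v + 2 * xorAux k x' y') + 2 * (u * v + 2 * andAux k x' y')
    ≡⟨ interchange (u ⊕ v) (xorAux k x' y') (u * v) (andAux k x' y') ⟩
  (u ⊕ v + 2 * (u * v)) + 2 * (xorAux k x' y' + 2 * andAux k x' y')
    ≡⟨ cong₂ (λ a b → a + 2 * b) (digit-sum u v (m%n<n x 2) (m%n<n y 2)) (xor-and-sum-fuel k (half-≤ x≤) (half-≤ y≤)) ⟩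
  (u + v) + 2 * (x' + y')
    ≡⟨ regroup u v x' y' ⟩
  (u + 2 * x') + (v + 2 * y')
    ≡⟨ cong₂ _+_ (digit-or-half x) (digit-or-half y) ⟨
  x + y ∎
  where
  open ≡-Reasoning
  u = x % 2
  v = y % 2
  x' = x / 2
  y' = y / 2
  _⊕_ : ℕ → ℕ → ℕ
  a ⊕ b = (a + b) % 2

sum-split : ∀ X Y → X + Y ≡ XOR X Y + CVT X Y
sum-split X Y = sym (xor-and-sum-fuel (X + Y) (m≤m+n X Y) (m≤n+m Y X))

Σ-≡ : ∀ {A : Set} {B : A → Set} → (∀ {a} (b c : B a) → b ≡ c) →
      {s t : Σ A B} → proj₁ s ≡ proj₁ t → s ≡ t
Σ-≡ irrelevant {a , b} {.a , c} refl = cong (a ,_) (irrelevant b c)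

≡×≡-irrelevant : ∀ {a b c d : ℕ} (p q : a ≡ b × c ≡ d) → p ≡ q
≡×≡-irrelevant (p₁ , p₂) (q₁ , q₂) = cong₂ _,_ (≡-irrelevant p₁ q₁) (≡-irrelevant p₂ q₂)

Fin1↔contractible : ∀ {S : Set} (c : S) → (∀ s → s ≡ c) → Fin 1 ↔ S
Fin1↔contractible c contract = mk↔ₛ′ (λ _ → c) (λ _ → zero) (λ s → sym (contract s)) (λ { zero → refl })

digit-cases : ∀ {b} → b < 2 → b ≡ 0 ⊎ b ≡ 1
digit-cases {0} _ = inj₁ refl
digit-cases {1} _ = inj₂ refl
digit-cases {suc (suc _)} (s≤s (s≤s ()))

IsDigitPair : ℕ → ℕ → ℕ × ℕ → Set
IsDigitPair a q (u , v) = u < 2 × v < 2 × u * v ≡ a × (u + v) % 2 ≡ q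

DigitPair : ℕ → ℕ → Set
DigitPair a q = Σ (ℕ × ℕ) (IsDigitPair a q)

digitPair-≡ : ∀ {a q} {d e : DigitPair a q} → proj₁ d ≡ proj₁ e → d ≡ e
digitPair-≡ = Σ-≡ λ { {u , v} (u<2 , v<2 , and , xor) (u<2′ , v<2′ , and′ , xor′) →
  cong₂ _,_ (≤-irrelevant u<2 u<2′) (cong₂ _,_ (≤-irrelevant v<2 v<2′)
    (≡×≡-irrelevant (and , xor) (and′ , xor′))) }

digitPair-even : ∀ {a u v} → IsDigitPair a 0 (u , v) → u ≡ a × v ≡ a
digitPair-even {u = 0} {0} (_ , _ , refl , _) = refl , refl
digitPair-even {u = 1} {1} (_ , _ , refl , _) = refl , refl
digitPair-even {u = 0} {1} (_ , _ , _ , ())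
digitPair-even {u = 1} {0} (_ , _ , _ , ())
digitPair-even {u = suc (suc _)} (s≤s (s≤s ()) , _)
digitPair-even {u = 0} {suc (suc _)} (_ , s≤s (s≤s ()) , _)
digitPair-even {u = 1} {suc (suc _)} (_ , s≤s (s≤s ()) , _)

digitPair-odd : ∀ {a u v} → IsDigitPair a 1 (u , v) → a ≡ 0 × ((u ≡ 0 × v ≡ 1) ⊎ (u ≡ 1 × v ≡ 0))
digitPair-odd {u = 0} {1} (_ , _ , refl , _) = refl , inj₁ (refl , refl)
digitPair-odd {u = 1} {0} (_ , _ , refl , _) = refl , inj₂ (refl , refl)
digitPair-odd {u = 0} {0} (_ , _ , _ , ())
digitPair-odd {u = 1} {1} (_ , _ , _ , ())
digitPair-odd {u = suc (suc _)} (s≤s (s≤s ()) , _)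
digitPair-odd {u = 0} {suc (suc _)} (_ , s≤s (s≤s ()) , _)
digitPair-odd {u = 1} {suc (suc _)} (_ , s≤s (s≤s ()) , _)

digitPairs-free : ∀ {a q} → a ≡ 0 × q ≡ 1 → Fin 2 ↔ DigitPair a q
digitPairs-free (refl , refl) = mk↔ₛ′ to from to∘from from∘to
  where
  to : Fin 2 → DigitPair 0 1
  to zero    = (0 , 1) , s≤s z≤n , s≤s (s≤s z≤n) , refl , refl
  to (suc _) = (1 , 0) , s≤s (s≤s z≤n) , s≤s z≤n , refl , refl
  from : DigitPair 0 1 → Fin 2
  from ((u , _) , _) with u ≟ 0
  ... | yes _ = zero
  ... | no  _ = suc zero
  to∘from : ∀ d → to (from d) ≡ d
  to∘from d@((u , v) , pair) with digitPair-odd {u = u} {v} pair | u ≟ 0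
  ... | _ , inj₁ (refl , refl) | yes _  = digitPair-≡ refl
  ... | _ , inj₁ (refl , refl) | no u≢0 = ⊥-elim (u≢0 refl)
  ... | _ , inj₂ (refl , refl) | yes ()
  ... | _ , inj₂ (refl , refl) | no _   = digitPair-≡ refl
  from∘to : ∀ i → from (to i) ≡ i
  from∘to zero          = refl
  from∘to (suc zero)    = refl

digitPair-xor : ∀ {a q p} → IsDigitPair a q p → q ≡ 0 ⊎ q ≡ 1
digitPair-xor {p = u , v} (_ , _ , _ , refl) = digit-cases (m%n<n (u + v) 2)

digitPair-forced : ∀ {a q} (d : DigitPair a q) → ¬ (a ≡ 0 × q ≡ 1) → ∀ e → e ≡ d
digitPair-forced ((u , v) , pair) not-free ((u′ , v′) , pair′) with digitPair-xor {p = u , v} pair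
... | inj₂ refl = ⊥-elim (not-free (proj₁ (digitPair-odd {u = u} {v} pair) , refl))
... | inj₁ refl with digitPair-even {u = u} {v} pair | digitPair-even {u = u′} {v′} pair′
...   | refl , refl | refl , refl = digitPair-≡ refl

Solves : ℕ → ℕ → ℕ × ℕ → Set
Solves A Q (X , Y) = AND X Y ≡ A × XOR X Y ≡ Q

Solution : ℕ → ℕ → Set
Solution A Q = Σ (ℕ × ℕ) (Solves A Q)

solution-≡ : ∀ {A Q} {s t : Solution A Q} → proj₁ s ≡ proj₁ t → s ≡ t
solution-≡ = Σ-≡ λ { {X , Y} → ≡×≡-irrelevant }

digits : ∀ {A Q} → Solution A Q → DigitPair (A % 2) (Q % 2)
digits {A} {Q} ((X , Y) , and , xor) =
  (X % 2 , Y % 2) , m%n<n X 2 , m%n<n Y 2 , proj₁ (And.run-split X Y A and) , proj₁ (Xor.run-split X Y Q xor)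

halve : ∀ {A Q} → Solution A Q → Solution (A / 2) (Q / 2)
halve {A} {Q} ((X , Y) , and , xor) = (X / 2 , Y / 2) , proj₂ (And.run-split X Y A and) , proj₂ (Xor.run-split X Y Q xor)

assemble : ∀ {A Q} → DigitPair (A % 2) (Q % 2) → Solution (A / 2) (Q / 2) → Solution A Q
assemble {A} {Q} ((u , v) , u<2 , v<2 , and₀ , xor₀) ((X , Y) , and , xor) =
  (u + 2 * X , v + 2 * Y) , And.run-join X Y A u<2 v<2 and₀ and , Xor.run-join X Y Q u<2 v<2 xor₀ xor

solution-split : ∀ A Q → Solution A Q ↔ (DigitPair (A % 2) (Q % 2) × Solution (A / 2) (Q / 2))
solution-split A Q = mk↔ₛ′ split (uncurry assemble) split∘assemble assemble∘split
  where
  split : Solution A Q → DigitPair (A % 2) (Q % 2) × Solution (A / 2) (Q / 2)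
  split s = digits s , halve s
  split∘assemble : ∀ p → split (uncurry assemble p) ≡ p
  split∘assemble (((u , v) , u<2 , v<2 , _) , ((X , Y) , _)) =
    cong₂ _,_ (digitPair-≡ (cong₂ _,_ (digit-of u X u<2) (digit-of v Y v<2)))
              (solution-≡ (cong₂ _,_ (half-of u X u<2) (half-of v Y v<2)))
  assemble∘split : ∀ s → uncurry assemble (split s) ≡ s
  assemble∘split ((X , Y) , _) = solution-≡ (cong₂ _,_ (sym (digit-or-half X)) (sym (digit-or-half Y)))

-- Position j is free for the system (A , Q) when A has digit 0 and Q digit 1 there;
-- the paper's count m counts the free positions of (P / 2 , Q).
Free : ℕ → ℕ → ℕ → Set
Free A Q j = bit A j ≡ 0 × bit Q j ≡ 1

free? : ∀ A Q → Decidable (Free A Q)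
free? A Q j = (bit A j ≟ 0) ×-dec (bit Q j ≟ 1)

freeCount : ℕ → ℕ → ℕ → ℕ
freeCount k A Q = length (filter (free? A Q) (upTo k))

length-filter-applyUpTo : ∀ {ℓ} {P : Pred ℕ ℓ} (P? : Decidable P) (f g : ℕ → ℕ) k →
  length (filter P? (applyUpTo (f ∘ g) k)) ≡ length (filter (P? ∘ f) (applyUpTo g k))
length-filter-applyUpTo P? f g zero = refl
length-filter-applyUpTo P? f g (suc k) with does (P? (f (g 0)))
... | true  = cong suc (length-filter-applyUpTo P? f (g ∘ suc) k)
... | false = length-filter-applyUpTo P? f (g ∘ suc) k

freeCount-shift : ∀ k A Q → length (filter (free? A Q) (applyUpTo suc k)) ≡ freeCount k (A / 2) (Q / 2)
freeCount-shift k A Q = length-filter-applyUpTo (free? A Q) suc (λ j → j) k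

freeCount-free : ∀ k A Q → Free A Q 0 → freeCount (suc k) A Q ≡ suc (freeCount k (A / 2) (Q / 2))
freeCount-free k A Q free =
  trans (cong length (filter-accept (free? A Q) {0} {applyUpTo suc k} free)) (cong suc (freeCount-shift k A Q))

freeCount-forced : ∀ k A Q → ¬ Free A Q 0 → freeCount (suc k) A Q ≡ freeCount k (A / 2) (Q / 2)
freeCount-forced k A Q forced =
  trans (cong length (filter-reject (free? A Q) {0} {applyUpTo suc k} forced)) (freeCount-shift k A Q)

half-< : ∀ k {A} → A < 2 ^ suc k → A / 2 < 2 ^ k
half-< k {A} A< = m<n*o⇒m/o<n (subst (A <_) (*-comm 2 (2 ^ k)) A<)

zero-solution : Solution 0 0
zero-solution = (0 , 0) , refl , refl

solution-zero : ∀ s → s ≡ zero-solution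
solution-zero ((X , Y) , and , xor) = solution-≡ (cong₂ _,_ (m+n≡0⇒m≡0 X X+Y≡0) (m+n≡0⇒n≡0 X X+Y≡0))
  where
  X+Y≡0 : X + Y ≡ 0
  X+Y≡0 = trans (sum-split X Y) (cong₂ (λ x a → x + 2 * a) xor and)

count-step : ∀ {m c A Q} → Fin m ↔ DigitPair (A % 2) (Q % 2) → Fin (2 ^ c) ↔ Solution (A / 2) (Q / 2) →
             Fin (m * 2 ^ c) ↔ Solution A Q
count-step {m} {c} {A} {Q} digitPairs solutions = begin
  Fin (m * 2 ^ c)                                          ↔⟨ *↔× ⟩
  (Fin m × Fin (2 ^ c))                                    ↔⟨ digitPairs ×-↔ solutions ⟩
  (DigitPair (A % 2) (Q % 2) × Solution (A / 2) (Q / 2))   ↔⟨ solution-split A Q ⟨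
  Solution A Q                                             ∎
  where open EquationalReasoning

count : ∀ k {A Q} → A < 2 ^ k → Q < 2 ^ k → Solution A Q → Fin (2 ^ freeCount k A Q) ↔ Solution A Q
count zero {0}     {0}     _         _         _ = Fin1↔contractible zero-solution solution-zero
count zero {suc _}         (s≤s ()) _         _
count zero {0}     {suc _} _         (s≤s ()) _
count (suc k) {A} {Q} A< Q< s = count-suc (free? A Q 0)
  where
  open EquationalReasoning
  c : ℕ
  c = freeCount k (A / 2) (Q / 2)
  halved : Fin (2 ^ c) ↔ Solution (A / 2) (Q / 2)
  halved = count k (half-< k A<) (half-< k Q<) (halve s)
  count-suc : Dec (Free A Q 0) → Fin (2 ^ freeCount (suc k) A Q) ↔ Solution A Q
  count-suc (yes free) = begin
    Fin (2 ^ freeCount (suc k) A Q)  ≡⟨ cong (λ n → Fin (2 ^ n)) (freeCount-free k A Q free) ⟩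
    Fin (2 * 2 ^ c)                  ↔⟨ count-step {c = c} (digitPairs-free free) halved ⟩
    Solution A Q                     ∎
  count-suc (no forced) = begin
    Fin (2 ^ freeCount (suc k) A Q)  ≡⟨ cong (λ n → Fin (2 ^ n)) (freeCount-forced k A Q forced) ⟩
    Fin (2 ^ c)                      ≡⟨ cong Fin (*-identityˡ (2 ^ c)) ⟨
    Fin (1 * 2 ^ c)                  ↔⟨ count-step {c = c} (Fin1↔contractible (digits s) (digitPair-forced (digits s) forced)) halved ⟩
    Solution A Q                     ∎

bit-digit : ∀ X j → bit X j < 2
bit-digit X zero    = m%n<n X 2
bit-digit X (suc j) = bit-digit (X / 2) j

bit-high : ∀ k {X} j → X < 2 ^ k → k ≤ j → bit X j ≡ 0
bit-high zero    {0} zero    _  _         = refl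
bit-high zero    {0} (suc j) _  _         = bit-high zero j (s≤s z≤n) z≤n
bit-high zero    {suc _} _   (s≤s ()) _
bit-high (suc k) {X} (suc j) X< (s≤s k≤j) = bit-high k j (half-< k X<) k≤j

cvt-half : ∀ X Y {P} → CVT X Y ≡ P → AND X Y ≡ P / 2
cvt-half X Y refl = sym (half-of 0 (AND X Y) (s≤s z≤n))

successor-solves : ∀ X Y {P Q} → CVT X Y ≡ P × XOR X Y ≡ Q → Solves (P / 2) Q (X , Y)
successor-solves X Y (cvt , xor) = cvt-half X Y cvt , xor

successor-even : ∀ {P Q} → Successors P Q → P ≡ 2 * (P / 2)
successor-even ((X , Y) , cvt , _) = trans (sym cvt) (cong (2 *_) (cvt-half X Y cvt))

successors↔solutions : ∀ P Q → P ≡ 2 * (P / 2) → Successors P Q ↔ Solution (P / 2) Q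
successors↔solutions P Q even = mk↔ₛ′ to from (λ s → solution-≡ refl) (λ s → Σ-≡ ≡×≡-irrelevant refl)
  where
  to : Successors P Q → Solution (P / 2) Q
  to ((X , Y) , succ) = (X , Y) , successor-solves X Y succ
  from : Solution (P / 2) Q → Successors P Q
  from ((X , Y) , and , xor) = (X , Y) , trans (cong (2 *_) and) (sym even) , xor

bit-pair : ∀ {A Q} X Y → Solves A Q (X , Y) → ∀ j → IsDigitPair (bit A j) (bit Q j) (bit X j , bit Y j)
bit-pair X Y sol zero    = proj₂ (digits ((X , Y) , sol))
bit-pair X Y sol (suc j) = bit-pair (X / 2) (Y / 2) (proj₂ (halve ((X , Y) , sol))) j

successor-digits : ∀ {P Q} (s : Successors P Q) j →
  IsDigitPair (bit (P / 2) j) (bit Q j) (bit (proj₁ (proj₁ s)) j , bit (proj₂ (proj₁ s)) j)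
successor-digits ((X , Y) , succ) = bit-pair X Y (successor-solves X Y succ)

special-digits : ∀ {n P Q} (s : Successors P Q) j → Special n P Q j →
                 let X = proj₁ (proj₁ s) ; Y = proj₂ (proj₁ s) in
                 (bit X j ≡ 0 × bit Y j ≡ 1) ⊎ (bit X j ≡ 1 × bit Y j ≡ 0)
special-digits s j (_ , _ , q≡1) =
  proj₂ (digitPair-odd (subst (λ q → IsDigitPair _ q _) q≡1 (successor-digits s j)))

-- Away from the special positions Q has digit 0: within the first n + 1 positions a
-- digit 1 of Q forces carry digit 0, i.e. a special position; beyond them Q < 2^(n+1).
forced-xor : ∀ {n P Q} → Q < 2 ^ suc n → Successors P Q → ∀ j → ¬ Special n P Q j → bit Q j ≡ 0
forced-xor {n} {Q = Q} Q< s j not-special with digit-cases (bit-digit Q j) | j <? suc n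
... | inj₁ q≡0 | _      = q≡0
... | inj₂ _   | no j≮  = bit-high (suc n) j Q< (≮⇒≥ j≮)
... | inj₂ q≡1 | yes j< = ⊥-elim (not-special (j< , carry≡0 , q≡1))
  where
  carry≡0 = proj₁ (digitPair-odd (subst (λ q → IsDigitPair _ q _) q≡1 (successor-digits s j)))

forced-digits : ∀ {n P Q} → Q < 2 ^ suc n → (s : Successors P Q) → ∀ j → ¬ Special n P Q j →
                bit (proj₁ (proj₁ s)) j ≡ bit (P / 2) j × bit (proj₂ (proj₁ s)) j ≡ bit (P / 2) j
forced-digits Q< s j not-special =
  digitPair-even (subst (λ q → IsDigitPair _ q _) (forced-xor Q< s j not-special) (successor-digits s j))

forced-digits-agree : ∀ {n P Q} → Q < 2 ^ suc n → (s t : Successors P Q) → ∀ j → ¬ Special n P Q j →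
  bit (proj₁ (proj₁ s)) j ≡ bit (proj₁ (proj₁ t)) j × bit (proj₂ (proj₁ s)) j ≡ bit (proj₂ (proj₁ t)) j
forced-digits-agree Q< s t j not-special
  with forced-digits Q< s j not-special | forced-digits Q< t j not-special
... | Xs≡a , Ys≡a | Xt≡a , Yt≡a = trans Xs≡a (sym Xt≡a) , trans Ys≡a (sym Yt≡a)

theorem4 : (n P Q : ℕ) → P < 2 ^ suc n → Q < 2 ^ suc n → NonLeaf P Q →
    (Fin (2 ^ countM n P Q) ↔ Successors P Q)
    × ((s : Successors P Q) → (j : ℕ) → Special n P Q j →
         (bit (proj₁ (proj₁ s)) j ≡ 0 × bit (proj₂ (proj₁ s)) j ≡ 1)
         ⊎ (bit (proj₁ (proj₁ s)) j ≡ 1 × bit (proj₂ (proj₁ s)) j ≡ 0))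
    × ((s t : Successors P Q) → (j : ℕ) → ¬ Special n P Q j →
         bit (proj₁ (proj₁ s)) j ≡ bit (proj₁ (proj₁ t)) j
         × bit (proj₂ (proj₁ s)) j ≡ bit (proj₂ (proj₁ t)) j)
theorem4 n P Q P< Q< nonLeaf = counting , special-digits , forced-digits-agree Q<
  where
  open EquationalReasoning
  solutions : Successors P Q ↔ Solution (P / 2) Q
  solutions = successors↔solutions P Q (successor-even nonLeaf)
  -- countM n P Q is by definition the number of free positions of (P / 2 , Q) below n + 1.
  counting : Fin (2 ^ countM n P Q) ↔ Successors P Q
  counting = begin
    Fin (2 ^ freeCount (suc n) (P / 2) Q) ↔⟨ count (suc n) (≤-<-trans (m/n≤m P 2) P<) Q< (Inverse.to solutions nonLeaf) ⟩
    Solution (P / 2) Q                    ↔⟨ solutions ⟨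
    Successors P Q                        ∎
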